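{- Let $\ell$ be an odd prime, $q=p^n$ a prime power, $k=\frac{q^\ell-1}{q-1}$, and $0\le a,b\le q-2$. If $p=\ell$, then $\#T_\ell(a,b)=1$ when $1+\omega^{ak}-\omega^{bk}=0$ and $\#T_\ell(a,b)=0$ when $1+\omega^{ak}-\omega^{bk}\ne0$. If $p\neq\ell$, then $0\le\#T_\ell(a,b)\le\ell-1$.
   Context: $\omega$ is a fixed generator of $\mathbb{F}_{q^\ell}^\times$, so $\omega^{ak}\in\mathbb{F}_q^\times$. $T_\ell(a,b):=\{x\in\mathbb{F}_q\mid x^\ell=\omega^{ak},\ (x+1)^\ell=\omega^{bk}\}$. -}

module Defs where

open import Level using (0ℓ)
open import Data.Nat using (ℕ; zero; suc)
open import Data.Nat.DivMod using (_/_)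
open import Data.Fin using (Fin)
open import Data.List using (List; map; filter; length; allFin)
open import Data.Product using (_×_; ∃)
open import Data.Product.Properties using (≡-dec)
open import Relation.Nullary using (Dec; _×-dec_)
open import Relation.Binary.PropositionalEquality using (_≡_; _≢_)
open import Relation.Binary.Definitions using (DecidableEquality)
open import Algebra.Structures using (IsCommutativeRing)
open import Function.Bundles using (_↔_; Inverse)

record FiniteField : Set₁ where
  infixl 6 _+_
  infixl 7 _*_
  infixr 8 _^_
  infix 4 _≟_
  field
    Carrier : Set
    _+_ _*_ : Carrier → Carrier → Carrier
    -_      : Carrier → Carrier
    0# 1#   : Carrier
    isCommutativeRing : IsCommutativeRing _≡_ _+_ _*_ -_ 0# 1#
    0≢1     : 0# ≢ 1#
    inverse : ∀ x → x ≢ 0# → ∃ λ y → x * y ≡ 1#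
    _≟_     : DecidableEquality Carrier
    size    : ℕ
    enum    : Carrier ↔ Fin size

  _^_ : Carrier → ℕ → Carrier
  x ^ zero  = 1#
  x ^ suc m = x * (x ^ m)

  elements : List Carrier
  elements = map (Inverse.from enum) (allFin size)

  count : {P : Carrier → Set} → (∀ x → Dec (P x)) → ℕ
  count P? = length (filter P? elements)

  IsGenerator : Carrier → Set
  IsGenerator ω = ω ≢ 0# × (∀ y → y ≢ 0# → ∃ λ m → ω ^ m ≡ y)

record IsRingHom (F E : FiniteField) (ι : FiniteField.Carrier F → FiniteField.Carrier E) : Set where
  private
    module F = FiniteField F
    module E = FiniteField E
  field
    +-hom : ∀ x y → ι (x F.+ y) ≡ ι x E.+ ι y
    *-hom : ∀ x y → ι (x F.* y) ≡ ι x E.* ι y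
    1-hom : ι F.1# ≡ E.1#

-- k = (q^ℓ - 1)/(q - 1)  (for q ≥ 2; junk value 0 otherwise)
kOf : ℕ → ℕ → ℕ
kOf q@(suc (suc m)) ℓ = (q Data.Nat.^ ℓ Data.Nat.∸ 1) / suc m
kOf _ ℓ = 0

-- #T_ℓ(a,b) = #{ x ∈ F_q | x^ℓ = ω^{ak}, (x+1)^ℓ = ω^{bk} },
-- where F_q is viewed inside F_{q^ℓ} via ι.
module _ (F E : FiniteField) (ι : FiniteField.Carrier F → FiniteField.Carrier E)
         (ω : FiniteField.Carrier E) (ℓ k a b : ℕ) where
  private
    module F = FiniteField F
    module E = FiniteField E

  #T : ℕ
  #T = F.count (λ x → (ι x E.^ ℓ E.≟ ω E.^ (a Data.Nat.* k))
                 ×-dec (ι (x F.+ F.1#) E.^ ℓ E.≟ ω E.^ (b Data.Nat.* k)))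

-- If p = ℓ, the Frobenius map x ↦ x^ℓ is additive and injective. So (x + 1)^ℓ = x^ℓ + 1 forces
-- ω^{bk} = 1 + ω^{ak} as soon as T is nonempty, and x ∈ T is determined by x^ℓ = ω^{ak}. Such an x
-- exists: ω^{ak} is fixed by y ↦ y^q because k(q − 1) = q^ℓ − 1, the fixed points of y ↦ y^q in
-- F_{q^ℓ} are exactly F_q since y^q − y has at most q roots, and every α ∈ F_q is the ℓ-th power of α^{q/ℓ}.
-- If p ≠ ℓ, every x ∈ T is a root of (y + 1)^ℓ − y^ℓ − (ω^{bk} − ω^{ak}), a polynomial of degree ℓ − 1
-- with leading coefficient ℓ ≠ 0, so there are at most ℓ − 1 of them.
-- The facts p · 1 = 0 and x^q = x both come from one translation argument: if g ∙_ permutes a finite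
-- list in a commutative monoid, then g^length fixes its product.

module Submission where

open import Defs
open import Level using (0ℓ)
open import Data.Nat as ℕ using (ℕ; zero; suc; _∸_; _<_; _≤_; z≤n; s≤s; _!)
import Data.Nat.Properties as ℕ
open import Data.Nat.Divisibility using (_∣_; _∤_; divides; ∣⇒≤; ∣1⇒≡1; _∣0; ∣m∣n⇒∣m+n; m∣m*n; n∣m*n)
open import Data.Nat.Primality using (Prime; ¬prime[0]; ¬prime[1]; euclidsLemma; prime⇒nonZero; prime⇒nonTrivial; prime⇒irreducible)
open import Data.Nat.Coprimality using (Coprime; coprime-Bézout)
open import Data.Nat.GCD using (module Bézout)
open import Data.Nat.Combinatorics using (_C_; nCn≡1; nCk≡n!/k![n-k]!; k![n∸k]!∣n!)
open import Data.Nat.DivMod using (_/_; m/n*n≡m)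
open import Data.Fin using (toℕ; inject₁)
open import Data.Fin.Patterns using (0F)
open import Data.Fin.Properties using (toℕ-inject₁; toℕ<n; toℕ-fromℕ)
open import Data.Vec.Functional using (init; tail; last)
open import Data.Product using (_×_; _,_; ∃; ∃₂; proj₂)
open import Data.Sum using (_⊎_; inj₁; inj₂; [_,_])
open import Function using (id; _∘_)
open import Relation.Nullary using (¬_; ¬?; Dec; contradiction; yes; no; _×-dec_)
open import Relation.Unary using (Decidable)
open import Relation.Binary.PropositionalEquality using (_≡_; _≢_; refl; sym; trans; cong; cong₂; subst; module ≡-Reasoning)
open import Algebra.Bundles using (CommutativeMonoid; CommutativeRing)
open import Data.List using (List; []; _∷_; map; length; foldr; filter; allFin)
open import Data.List.Properties using (length-map; length-tabulate; filter-accept; filter-reject; filter-none)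
open import Data.List.Relation.Binary.Permutation.Propositional using (_↭_; ↭⇒↭ₛ′)
open import Data.List.Relation.Binary.Permutation.Propositional.Properties using (↭-length)
open import Data.List.Relation.Unary.All using (All; []; _∷_)
import Data.List.Relation.Unary.All as All
import Data.List.Relation.Unary.All.Properties as All
open import Data.List.Relation.Unary.Any using (Any; here; there; any?; satisfied)
open import Data.List.Relation.Binary.BagAndSetEquality using (∼bag⇒↭)
open import Data.List.Membership.Propositional using (_∈_; lose)
open import Data.List.Membership.Propositional.Properties using (∈-map⁺; ∈-map⁻; ∈-allFin; ∈-filter⁺; ∈-filter⁻)
open import Data.List.Membership.Propositional.Properties.WithK using (unique∧set⇒bag)
open import Data.List.Relation.Unary.Unique.Propositional using (Unique)
import Data.List.Relation.Unary.Unique.Propositional.Properties as Unique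
open import Data.List.Relation.Unary.AllPairs using (_∷_)
open import Function.Bundles using (mk⇔; Inverse)

prime∤! : ∀ {p} → Prime p → ∀ {m} → m < p → p ∤ m !
prime∤! p-prime {zero} _ p∣1 = ℕ.nonTrivial⇒≢1 {{prime⇒nonTrivial p-prime}} (∣1⇒≡1 p∣1)
prime∤! p-prime {suc m} m<p p∣m! with euclidsLemma (suc m) (m !) p-prime p∣m!
... | inj₁ p∣1+m = ℕ.<⇒≱ m<p (∣⇒≤ p∣1+m)
... | inj₂ p∣m! = prime∤! p-prime (ℕ.<-trans (ℕ.n<1+n m) m<p) p∣m!

n∣n! : ∀ n → .{{ℕ.NonZero n}} → n ∣ n !
n∣n! (suc n) = m∣m*n (n !)

n!≡nCk*k![n∸k]! : ∀ {n k} → k ≤ n → n ! ≡ (n C k) ℕ.* (k ! ℕ.* (n ∸ k) !)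
n!≡nCk*k![n∸k]! {n} {k} k≤n = sym (begin
  (n C k) ℕ.* (k ! ℕ.* (n ∸ k) !) ≡⟨ cong (ℕ._* (k ! ℕ.* (n ∸ k) !)) (nCk≡n!/k![n-k]! k≤n) ⟩
  n ! / (k ! ℕ.* (n ∸ k) !) ℕ.* (k ! ℕ.* (n ∸ k) !) ≡⟨ m/n*n≡m (k![n∸k]!∣n! k≤n) ⟩
  n ! ∎)
  where
  open ≡-Reasoning
  instance _ = k ℕ.!* (n ∸ k) !≢0

prime∣pCk : ∀ {p k} → Prime p → 0 < k → k < p → p ∣ p C k
prime∣pCk {p} {k} p-prime 0<k k<p
  with euclidsLemma (p C k) (k ! ℕ.* (p ∸ k) !) p-prime
         (subst (p ∣_) (n!≡nCk*k![n∸k]! (ℕ.<⇒≤ k<p)) (n∣n! p {{prime⇒nonZero p-prime}}))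
... | inj₁ p∣pCk = p∣pCk
... | inj₂ p∣k![p∸k]! with euclidsLemma (k !) ((p ∸ k) !) p-prime p∣k![p∸k]!
...   | inj₁ p∣k! = contradiction p∣k! (prime∤! p-prime k<p)
...   | inj₂ p∣[p∸k]! = contradiction p∣[p∸k]! (prime∤! p-prime (ℕ.∸-monoʳ-< 0<k (ℕ.<⇒≤ k<p)))

distinct-primes⇒coprime : ∀ {p q} → Prime p → Prime q → p ≢ q → Coprime p q
distinct-primes⇒coprime p-prime q-prime p≢q (d∣p , d∣q) with prime⇒irreducible p-prime d∣p
... | inj₁ d≡1 = d≡1
... | inj₂ refl with prime⇒irreducible q-prime d∣q
...   | inj₁ p≡1 = contradiction p≡1 (ℕ.nonTrivial⇒≢1 {{prime⇒nonTrivial p-prime}})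
...   | inj₂ p≡q = contradiction p≡q p≢q

m∣[1+m]^j∸1 : ∀ m j → m ∣ suc m ℕ.^ j ∸ 1
m∣[1+m]^j∸1 m zero = m ∣0
m∣[1+m]^j∸1 m (suc j) with suc m ℕ.^ j | ℕ.m^n>0 (suc m) j | m∣[1+m]^j∸1 m j
... | suc r | _ | m∣r = ∣m∣n⇒∣m+n m∣r (m∣m*n (suc r))

kOf[q]*[q∸1]≡q^ℓ∸1 : ∀ {q} ℓ → 1 < q → kOf q ℓ ℕ.* (q ∸ 1) ≡ q ℕ.^ ℓ ∸ 1
kOf[q]*[q∸1]≡q^ℓ∸1 {suc (suc m)} ℓ (s≤s (s≤s z≤n)) = m/n*n≡m (m∣[1+m]^j∸1 (suc m) ℓ)

length-filter≡1 : ∀ {A : Set} {P : A → Set} (P? : Decidable P) {xs x} → Unique xs → x ∈ xs → P x →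
                  (∀ {y} → P y → y ≡ x) → length (filter P? xs) ≡ 1
length-filter≡1 P? {y ∷ ys} (y∉ys ∷ ys!) (here refl) Py P⇒≡y =
  cong length (trans (filter-accept P? Py) (cong (y ∷_) (filter-none P? (All.map (λ y≢z Pz → y≢z (sym (P⇒≡y Pz))) y∉ys))))
length-filter≡1 {P = P} P? {y ∷ ys} (y∉ys ∷ ys!) (there x∈ys) Px P⇒≡x =
  trans (cong length (filter-reject P? ¬Py)) (length-filter≡1 P? ys! x∈ys Px P⇒≡x)
  where
  ¬Py : ¬ P y
  ¬Py Py = All.lookup y∉ys (subst (_∈ ys) (sym (P⇒≡x Py)) x∈ys) refl

unique∧⊆∧⊇⇒↭ : ∀ {A : Set} {xs ys : List A} → Unique xs → Unique ys →
               (∀ {z} → z ∈ xs → z ∈ ys) → (∀ {z} → z ∈ ys → z ∈ xs) → xs ↭ ys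
unique∧⊆∧⊇⇒↭ xs! ys! xs⊆ys ys⊆xs = ∼bag⇒↭ (unique∧set⇒bag xs! ys! (mk⇔ xs⊆ys ys⊆xs))

map-↭-self : ∀ {A : Set} {f : A → A} {xs} → (∀ {x y} → f x ≡ f y → x ≡ y) → Unique xs →
             (∀ {x} → x ∈ xs → f x ∈ xs) → (∀ {y} → y ∈ xs → ∃ λ x → x ∈ xs × f x ≡ y) → map f xs ↭ xs
map-↭-self {f = f} f-injective xs! maps-into maps-onto =
  unique∧⊆∧⊇⇒↭ (Unique.map⁺ f-injective xs!) xs! image⊆xs xs⊆image
  where
  image⊆xs : ∀ {z} → z ∈ map f _ → z ∈ _
  image⊆xs z∈image with ∈-map⁻ f z∈image
  ... | x , x∈xs , refl = maps-into x∈xs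
  xs⊆image : ∀ {z} → z ∈ _ → z ∈ map f _
  xs⊆image z∈xs with maps-onto z∈xs
  ... | x , x∈xs , refl = ∈-map⁺ f x∈xs

module _ {c ℓ} (M : CommutativeMonoid c ℓ) where
  open CommutativeMonoid M using (_∙_; ε; _≈_; ∙-congˡ; identityˡ; rawMonoid; setoid; isEquivalence; isCommutativeMonoid)
  private module M = CommutativeMonoid M
  open import Algebra.Definitions.RawMonoid rawMonoid using () renaming (_×_ to _·_)
  open import Algebra.Solver.CommutativeMonoid M using (solve; _⊕_; _⊜_)
  open import Data.List.Relation.Binary.Permutation.Setoid.Properties setoid using (foldr-commMonoid)
  open import Relation.Binary.Reasoning.Setoid setoid

  foldr-map-∙ˡ : ∀ g xs → foldr _∙_ ε (map (g ∙_) xs) ≈ (length xs · g) ∙ foldr _∙_ ε xs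
  foldr-map-∙ˡ g [] = M.sym (identityˡ ε)
  foldr-map-∙ˡ g (x ∷ xs) = begin
    (g ∙ x) ∙ foldr _∙_ ε (map (g ∙_) xs)  ≈⟨ ∙-congˡ (foldr-map-∙ˡ g xs) ⟩
    (g ∙ x) ∙ ((length xs · g) ∙ Πxs)
      ≈⟨ solve 4 (λ g x n Π → (g ⊕ x) ⊕ (n ⊕ Π) ⊜ (g ⊕ n) ⊕ (x ⊕ Π)) M.refl g x (length xs · g) Πxs ⟩
    (g ∙ (length xs · g)) ∙ (x ∙ Πxs)      ∎
    where Πxs = foldr _∙_ ε xs

  ∙-permutes⇒length·g∙foldr≈foldr : ∀ g xs → map (g ∙_) xs ↭ xs → (length xs · g) ∙ foldr _∙_ ε xs ≈ foldr _∙_ ε xs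
  ∙-permutes⇒length·g∙foldr≈foldr g xs σ = begin
    (length xs · g) ∙ foldr _∙_ ε xs  ≈⟨ foldr-map-∙ˡ g xs ⟨
    foldr _∙_ ε (map (g ∙_) xs)       ≈⟨ foldr-commMonoid isCommutativeMonoid (↭⇒↭ₛ′ isEquivalence σ) ⟩
    foldr _∙_ ε xs                    ∎

module FiniteFieldProperties (K : FiniteField) where
  open FiniteField K public

  commutativeRing : CommutativeRing 0ℓ 0ℓ
  commutativeRing = record { isCommutativeRing = isCommutativeRing }

  open CommutativeRing commutativeRing public
    using (+-comm; +-identityˡ; +-identityʳ;
           *-assoc; *-comm; *-identityˡ; *-identityʳ; zeroˡ; zeroʳ;
           +-rawMonoid; +-commutativeMonoid; *-commutativeMonoid; semiring; commutativeSemiring; ring)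
  open import Algebra.Properties.Group (CommutativeRing.+-group commutativeRing) public
    using (x∙y⁻¹≈ε⇒x≈y; x≈y⇒x∙y⁻¹≈ε; //-rightDividesˡ; //-rightDividesʳ; ∙-cancelˡ; ∙-cancelʳ)
  open import Algebra.Properties.Ring ring public using (-‿distribʳ-*)
  open import Algebra.Definitions.RawMonoid +-rawMonoid public using () renaming (_×_ to _·_)
  open import Algebra.Properties.Semiring.Mult semiring public using (×1-homo-*; ×-assoc-*; ×-homo-+)
  open import Algebra.Properties.Semiring.Exp semiring using (^-assocʳ) renaming (_^_ to _^ᴿ_)
  open import Algebra.Properties.Semiring.Sum semiring using (sum; sum-init-last; sum-cong-≗; sum-replicate-zero)
  open import Algebra.Properties.CommutativeSemiring.Binomial commutativeSemiring using (theorem; binomialTerm)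
  open import Algebra.Solver.Ring.NaturalCoefficients.Default commutativeSemiring
    using (solve; _:=_; _:+_; _:*_; con)

  1≢0 : 1# ≢ 0#
  1≢0 1≡0 = 0≢1 (sym 1≡0)

  x+z≡z⇒x≡0 : ∀ {x z} → x + z ≡ z → x ≡ 0#
  x+z≡z⇒x≡0 {x} {z} x+z≡z = ∙-cancelʳ z x 0# (trans x+z≡z (sym (+-identityˡ z)))

  *-cancelˡ : ∀ {x y z} → x ≢ 0# → x * y ≡ x * z → y ≡ z
  *-cancelˡ {x} {y} {z} x≢0 xy≡xz with inverse x x≢0
  ... | x⁻¹ , xx⁻¹≡1 = begin
    y                ≡⟨ *-identityˡ y ⟨
    1# * y           ≡⟨ cong (_* y) (trans (sym xx⁻¹≡1) (*-comm x x⁻¹)) ⟩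
    (x⁻¹ * x) * y    ≡⟨ *-assoc x⁻¹ x y ⟩
    x⁻¹ * (x * y)    ≡⟨ cong (x⁻¹ *_) xy≡xz ⟩
    x⁻¹ * (x * z)    ≡⟨ *-assoc x⁻¹ x z ⟨
    (x⁻¹ * x) * z    ≡⟨ cong (_* z) (trans (*-comm x⁻¹ x) xx⁻¹≡1) ⟩
    1# * z           ≡⟨ *-identityˡ z ⟩
    z                ∎
    where open ≡-Reasoning

  x*y≡0⇒x≡0∨y≡0 : ∀ {x y} → x * y ≡ 0# → x ≡ 0# ⊎ y ≡ 0#
  x*y≡0⇒x≡0∨y≡0 {x} {y} xy≡0 with x ≟ 0#
  ... | yes x≡0 = inj₁ x≡0
  ... | no x≢0 = inj₂ (*-cancelˡ x≢0 (trans xy≡0 (sym (zeroʳ x))))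

  x≢0∧y≢0⇒x*y≢0 : ∀ {x y} → x ≢ 0# → y ≢ 0# → x * y ≢ 0#
  x≢0∧y≢0⇒x*y≢0 x≢0 y≢0 xy≡0 = [ x≢0 , y≢0 ] (x*y≡0⇒x≡0∨y≡0 xy≡0)

  x^n≡0⇒x≡0 : ∀ {x} n → x ^ n ≡ 0# → x ≡ 0#
  x^n≡0⇒x≡0 zero 1≡0 = contradiction 1≡0 1≢0
  x^n≡0⇒x≡0 (suc n) xxⁿ≡0 = [ id , x^n≡0⇒x≡0 n ] (x*y≡0⇒x≡0∨y≡0 xxⁿ≡0)

  ^≗^ᴿ : ∀ x n → x ^ n ≡ x ^ᴿ n
  ^≗^ᴿ x zero = refl
  ^≗^ᴿ x (suc n) = cong (x *_) (^≗^ᴿ x n)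

  ^-* : ∀ x m n → x ^ (m ℕ.* n) ≡ (x ^ m) ^ n
  ^-* x m n = begin
    x ^ (m ℕ.* n)      ≡⟨ ^≗^ᴿ x (m ℕ.* n) ⟩
    x ^ᴿ (m ℕ.* n)     ≡⟨ ^-assocʳ x m n ⟨
    (x ^ᴿ m) ^ᴿ n      ≡⟨ ^≗^ᴿ (x ^ᴿ m) n ⟨
    (x ^ᴿ m) ^ n       ≡⟨ cong (_^ n) (^≗^ᴿ x m) ⟨
    (x ^ m) ^ n        ∎
    where open ≡-Reasoning

  1^n≡1 : ∀ n → 1# ^ n ≡ 1#
  1^n≡1 zero = refl
  1^n≡1 (suc n) = trans (*-identityˡ _) (1^n≡1 n)

  ∈-elements : ∀ x → x ∈ elements
  ∈-elements x = subst (_∈ elements) (Inverse.strictlyInverseʳ enum x)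
    (∈-map⁺ (Inverse.from enum) (∈-allFin (Inverse.to enum x)))

  elements-unique : Unique elements
  elements-unique = Unique.map⁺ from-injective (Unique.allFin⁺ size)
    where
    from-injective : ∀ {i j} → Inverse.from enum i ≡ Inverse.from enum j → i ≡ j
    from-injective {i} {j} eq = begin
      i                                     ≡⟨ Inverse.strictlyInverseˡ enum i ⟨
      Inverse.to enum (Inverse.from enum i) ≡⟨ cong (Inverse.to enum) eq ⟩
      Inverse.to enum (Inverse.from enum j) ≡⟨ Inverse.strictlyInverseˡ enum j ⟩
      j                                     ∎
      where open ≡-Reasoning

  length-elements : length elements ≡ size
  length-elements = trans (length-map _ (allFin size)) (length-tabulate id)

  size·1≡0 : size · 1# ≡ 0#
  size·1≡0 = x+z≡z⇒x≡0 (subst (λ n → n · 1# + Σ ≡ Σ) length-elements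
    (∙-permutes⇒length·g∙foldr≈foldr +-commutativeMonoid 1# elements
      (map-↭-self (∙-cancelˡ 1# _ _) elements-unique (λ _ → ∈-elements _) (λ {y} _ → y + - 1# , ∈-elements _ , 1+[y-1]≡y y))))
    where
    Σ = foldr _+_ 0# elements
    1+[y-1]≡y : ∀ y → 1# + (y + - 1#) ≡ y
    1+[y-1]≡y y = trans (+-comm 1# _) (//-rightDividesˡ 1# y)

  nonzero? : ∀ x → Dec (x ≢ 0#)
  nonzero? x = ¬? (x ≟ 0#)

  nonzeros : List Carrier
  nonzeros = filter nonzero? elements

  ∈-nonzeros⁻ : ∀ {x} → x ∈ nonzeros → x ≢ 0#
  ∈-nonzeros⁻ x∈nonzeros = proj₂ (∈-filter⁻ nonzero? {xs = elements} x∈nonzeros)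

  ∈-nonzeros⁺ : ∀ {x} → x ≢ 0# → x ∈ nonzeros
  ∈-nonzeros⁺ x≢0 = ∈-filter⁺ nonzero? (∈-elements _) x≢0

  nonzeros-unique : Unique nonzeros
  nonzeros-unique = Unique.filter⁺ nonzero? elements-unique

  size≡1+length-nonzeros : size ≡ suc (length nonzeros)
  size≡1+length-nonzeros = trans (sym length-elements) (↭-length elements↭0∷nonzeros)
    where
    ⊆0∷nonzeros : ∀ {z} → z ∈ elements → z ∈ 0# ∷ nonzeros
    ⊆0∷nonzeros {z} _ with z ≟ 0#
    ... | yes z≡0 = here z≡0
    ... | no z≢0 = there (∈-nonzeros⁺ z≢0)
    elements↭0∷nonzeros : elements ↭ 0# ∷ nonzeros
    elements↭0∷nonzeros = unique∧⊆∧⊇⇒↭ elements-unique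
      (All.tabulate (λ z∈nonzeros 0≡z → ∈-nonzeros⁻ z∈nonzeros (sym 0≡z)) ∷ nonzeros-unique)
      ⊆0∷nonzeros (λ _ → ∈-elements _)

  product≢0 : ∀ {xs} → All (_≢ 0#) xs → foldr _*_ 1# xs ≢ 0#
  product≢0 [] = 1≢0
  product≢0 (x≢0 ∷ xs≢0) = x≢0∧y≢0⇒x*y≢0 x≢0 (product≢0 xs≢0)

  x^[size∸1]≡1 : ∀ {x} → x ≢ 0# → x ^ (size ∸ 1) ≡ 1#
  x^[size∸1]≡1 {x} x≢0 with inverse x x≢0
  ... | x⁻¹ , xx⁻¹≡1 = *-cancelˡ (product≢0 (All.tabulate ∈-nonzeros⁻)) (begin
    Π * x ^ (size ∸ 1)            ≡⟨ cong (λ n → Π * x ^ (n ∸ 1)) size≡1+length-nonzeros ⟩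
    Π * x ^ length nonzeros       ≡⟨ *-comm Π _ ⟩
    x ^ length nonzeros * Π       ≡⟨ cong (_* Π) (^≗^ᴿ x (length nonzeros)) ⟩
    x ^ᴿ length nonzeros * Π      ≡⟨ ∙-permutes⇒length·g∙foldr≈foldr *-commutativeMonoid x nonzeros x*-permutes ⟩
    Π                             ≡⟨ *-identityʳ Π ⟨
    Π * 1#                        ∎)
    where
    open ≡-Reasoning
    Π = foldr _*_ 1# nonzeros
    x⁻¹≢0 : x⁻¹ ≢ 0#
    x⁻¹≢0 x⁻¹≡0 = 1≢0 (trans (sym xx⁻¹≡1) (trans (cong (x *_) x⁻¹≡0) (zeroʳ x)))
    x[x⁻¹y]≡y : ∀ y → x * (x⁻¹ * y) ≡ y
    x[x⁻¹y]≡y y = trans (sym (*-assoc x x⁻¹ y)) (trans (cong (_* y) xx⁻¹≡1) (*-identityˡ y))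
    x*-permutes : map (x *_) nonzeros ↭ nonzeros
    x*-permutes = map-↭-self (*-cancelˡ x≢0) nonzeros-unique
      (λ y∈nonzeros → ∈-nonzeros⁺ (x≢0∧y≢0⇒x*y≢0 x≢0 (∈-nonzeros⁻ y∈nonzeros)))
      (λ {y} y∈nonzeros → x⁻¹ * y , ∈-nonzeros⁺ (x≢0∧y≢0⇒x*y≢0 x⁻¹≢0 (∈-nonzeros⁻ y∈nonzeros)) , x[x⁻¹y]≡y y)

  size≡1+[size∸1] : size ≡ suc (size ∸ 1)
  size≡1+[size∸1] = trans size≡1+length-nonzeros (cong (λ n → suc (n ∸ 1)) (sym size≡1+length-nonzeros))

  1<size : 1 < size
  1<size = subst (1 <_) (sym size≡1+length-nonzeros) (s≤s (nonempty (∈-nonzeros⁺ 1≢0)))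
    where
    nonempty : ∀ {x : Carrier} {xs} → x ∈ xs → 1 ≤ length xs
    nonempty (here _)  = s≤s z≤n
    nonempty (there _) = s≤s z≤n

  x^size≡x : ∀ x → x ^ size ≡ x
  x^size≡x x with x ≟ 0#
  ... | yes refl = trans (cong (0# ^_) size≡1+[size∸1]) (zeroˡ _)
  ... | no x≢0 = begin
    x ^ size              ≡⟨ cong (x ^_) size≡1+[size∸1] ⟩
    x * x ^ (size ∸ 1)    ≡⟨ cong (x *_) (x^[size∸1]≡1 x≢0) ⟩
    x * 1#                ≡⟨ *-identityʳ x ⟩
    x                     ∎
    where open ≡-Reasoning

  [x^[p^n]]^p≡x : ∀ {p n} → size ≡ p ℕ.^ suc n → ∀ x → (x ^ (p ℕ.^ n)) ^ p ≡ x
  [x^[p^n]]^p≡x {p} {n} size≡p^[1+n] x = begin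
    (x ^ (p ℕ.^ n)) ^ p    ≡⟨ ^-* x (p ℕ.^ n) p ⟨
    x ^ (p ℕ.^ n ℕ.* p)    ≡⟨ cong (x ^_) (trans (ℕ.*-comm (p ℕ.^ n) p) (sym size≡p^[1+n])) ⟩
    x ^ size               ≡⟨ x^size≡x x ⟩
    x                      ∎
    where open ≡-Reasoning

  x^[j*k]^q≡x^[j*k] : ∀ {q ℓ} → size ≡ q ℕ.^ ℓ → 1 < q → ∀ {x} → x ≢ 0# → ∀ j →
                      (x ^ (j ℕ.* kOf q ℓ)) ^ q ≡ x ^ (j ℕ.* kOf q ℓ)
  x^[j*k]^q≡x^[j*k] {q@(suc q′)} {ℓ} size≡q^ℓ 1<q {x} x≢0 j = begin
    y * y ^ q′    ≡⟨ cong (y *_) y^q′≡1 ⟩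
    y * 1#        ≡⟨ *-identityʳ y ⟩
    y             ∎
    where
    open ≡-Reasoning
    k = kOf q ℓ
    y = x ^ (j ℕ.* k)
    y^q′≡1 : y ^ q′ ≡ 1#
    y^q′≡1 = begin
      (x ^ (j ℕ.* k)) ^ q′       ≡⟨ ^-* x (j ℕ.* k) q′ ⟨
      x ^ (j ℕ.* k ℕ.* q′)       ≡⟨ cong (x ^_) (trans (ℕ.*-assoc j k q′) (ℕ.*-comm j (k ℕ.* q′))) ⟩
      x ^ (k ℕ.* q′ ℕ.* j)       ≡⟨ ^-* x (k ℕ.* q′) j ⟩
      (x ^ (k ℕ.* q′)) ^ j
        ≡⟨ cong (λ e → (x ^ e) ^ j) (trans (kOf[q]*[q∸1]≡q^ℓ∸1 ℓ 1<q) (cong (_∸ 1) (sym size≡q^ℓ))) ⟩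
      (x ^ (size ∸ 1)) ^ j       ≡⟨ cong (_^ j) (x^[size∸1]≡1 x≢0) ⟩
      1# ^ j                     ≡⟨ 1^n≡1 j ⟩
      1#                         ∎

  n·x≡[n·1]*x : ∀ n x → n · x ≡ (n · 1#) * x
  n·x≡[n·1]*x n x = trans (cong (n ·_) (sym (*-identityˡ x))) (sym (×-assoc-* n 1# x))

  p·1≡0∧p∣n⇒n·x≡0 : ∀ {p n} → p · 1# ≡ 0# → p ∣ n → ∀ x → n · x ≡ 0#
  p·1≡0∧p∣n⇒n·x≡0 {p} p·1≡0 (divides j refl) x = begin
    (j ℕ.* p) · x              ≡⟨ n·x≡[n·1]*x (j ℕ.* p) x ⟩
    ((j ℕ.* p) · 1#) * x       ≡⟨ cong (_* x) (×1-homo-* j p) ⟩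
    ((j · 1#) * (p · 1#)) * x  ≡⟨ cong (λ z → ((j · 1#) * z) * x) p·1≡0 ⟩
    ((j · 1#) * 0#) * x        ≡⟨ cong (_* x) (zeroʳ _) ⟩
    0# * x                     ≡⟨ zeroˡ x ⟩
    0#                         ∎
    where open ≡-Reasoning

  [m^n]·1≡[m·1]^n : ∀ m n → (m ℕ.^ n) · 1# ≡ (m · 1#) ^ n
  [m^n]·1≡[m·1]^n m zero = +-identityʳ 1#
  [m^n]·1≡[m·1]^n m (suc n) = trans (×1-homo-* m (m ℕ.^ n)) (cong ((m · 1#) *_) ([m^n]·1≡[m·1]^n m n))

  size≡p^n⇒p·1≡0 : ∀ {p n} → 0 < n → size ≡ p ℕ.^ n → p · 1# ≡ 0#
  size≡p^n⇒p·1≡0 {p} {n} 0<n size≡p^n = x^n≡0⇒x≡0 n (begin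
    (p · 1#) ^ n      ≡⟨ [m^n]·1≡[m·1]^n p n ⟨
    (p ℕ.^ n) · 1#    ≡⟨ cong (_· 1#) size≡p^n ⟨
    size · 1#         ≡⟨ size·1≡0 ⟩
    0#                ∎)
    where open ≡-Reasoning

  u·1≡0∧v·1≡0⇒1+b*u≢a*v : ∀ {u v} a b → u · 1# ≡ 0# → v · 1# ≡ 0# → 1 ℕ.+ b ℕ.* u ≢ a ℕ.* v
  u·1≡0∧v·1≡0⇒1+b*u≢a*v {u} {v} a b u·1≡0 v·1≡0 1+bu≡av = 1≢0 (begin
    1#                          ≡⟨ +-identityʳ 1# ⟨
    1 · 1#                      ≡⟨ +-identityʳ (1 · 1#) ⟨
    1 · 1# + 0#                 ≡⟨ cong (1 · 1# +_) (p·1≡0∧p∣n⇒n·x≡0 u·1≡0 (n∣m*n b) 1#) ⟨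
    1 · 1# + (b ℕ.* u) · 1#     ≡⟨ ×-homo-+ 1# 1 (b ℕ.* u) ⟨
    (1 ℕ.+ b ℕ.* u) · 1#        ≡⟨ cong (_· 1#) 1+bu≡av ⟩
    (a ℕ.* v) · 1#              ≡⟨ p·1≡0∧p∣n⇒n·x≡0 v·1≡0 (n∣m*n a) 1# ⟩
    0#                          ∎)
    where open ≡-Reasoning

  coprime∧m·1≡0⇒n·1≢0 : ∀ {m n} → Coprime m n → m · 1# ≡ 0# → n · 1# ≢ 0#
  coprime∧m·1≡0⇒n·1≢0 coprime m·1≡0 n·1≡0 with coprime-Bézout coprime
  ... | Bézout.+- a b 1+bn≡am = u·1≡0∧v·1≡0⇒1+b*u≢a*v a b n·1≡0 m·1≡0 1+bn≡am
  ... | Bézout.-+ a b 1+am≡bn = u·1≡0∧v·1≡0⇒1+b*u≢a*v b a m·1≡0 n·1≡0 1+am≡bn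

  frobenius-+ : ∀ {p} → Prime p → p · 1# ≡ 0# → ∀ x y → (x + y) ^ p ≡ x ^ p + y ^ p
  frobenius-+ {0} p-prime = contradiction p-prime ¬prime[0]
  frobenius-+ {1} p-prime = contradiction p-prime ¬prime[1]
  frobenius-+ {p@(suc (suc m))} p-prime p·1≡0 x y = begin
    (x + y) ^ p                                  ≡⟨ ^≗^ᴿ (x + y) p ⟩
    (x + y) ^ᴿ p                                 ≡⟨ theorem p x y ⟩
    sum t                                        ≡⟨ sum-init-last t ⟩
    (t 0F + sum (tail (init t))) + last t
      ≡⟨ cong (λ s → (t 0F + s) + last t) (trans (sum-cong-≗ middle≡0) (sum-replicate-zero (suc m))) ⟩
    (t 0F + 0#) + last t                         ≡⟨ cong₂ _+_ first≡yᵖ last≡xᵖ ⟩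
    y ^ p + x ^ p                                ≡⟨ +-comm _ _ ⟩
    x ^ p + y ^ p                                ∎
    where
    open ≡-Reasoning
    t = binomialTerm x y p
    middle≡0 : ∀ i → tail (init t) i ≡ 0#
    middle≡0 i = p·1≡0∧p∣n⇒n·x≡0 p·1≡0 (prime∣pCk p-prime (s≤s z≤n) (s≤s k<1+m)) _
      where
      k<1+m : toℕ (inject₁ i) < suc m
      k<1+m = subst (_< suc m) (sym (toℕ-inject₁ i)) (toℕ<n i)
    first≡yᵖ : t 0F + 0# ≡ y ^ p
    first≡yᵖ = begin
      t 0F + 0#             ≡⟨ +-identityʳ _ ⟩
      1 · (1# * y ^ᴿ p)     ≡⟨ +-identityʳ _ ⟩
      1# * y ^ᴿ p           ≡⟨ *-identityˡ _ ⟩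
      y ^ᴿ p                ≡⟨ ^≗^ᴿ y p ⟨
      y ^ p                 ∎
    last≡xᵖ : last t ≡ x ^ p
    last≡xᵖ = begin
      last t                               ≡⟨ cong (λ k → (p C k) · (x ^ᴿ k * y ^ᴿ (p ∸ k))) (toℕ-fromℕ p) ⟩
      (p C p) · (x ^ᴿ p * y ^ᴿ (p ∸ p))    ≡⟨ cong₂ (λ c k → c · (x ^ᴿ p * y ^ᴿ k)) (nCn≡1 p) (ℕ.n∸n≡0 p) ⟩
      1 · (x ^ᴿ p * 1#)                    ≡⟨ +-identityʳ _ ⟩
      x ^ᴿ p * 1#                          ≡⟨ *-identityʳ _ ⟩
      x ^ᴿ p                               ≡⟨ ^≗^ᴿ x p ⟨
      x ^ p                                ∎

  frobenius-injective : ∀ {p} → Prime p → p · 1# ≡ 0# → ∀ {x y} → x ^ p ≡ y ^ p → x ≡ y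
  frobenius-injective {p} p-prime p·1≡0 {x} {y} xᵖ≡yᵖ = x∙y⁻¹≈ε⇒x≈y x y (x^n≡0⇒x≡0 p (x+z≡z⇒x≡0 (begin
    (x + - y) ^ p + y ^ p    ≡⟨ frobenius-+ p-prime p·1≡0 (x + - y) y ⟨
    ((x + - y) + y) ^ p      ≡⟨ cong (_^ p) (//-rightDividesˡ y x) ⟩
    x ^ p                    ≡⟨ xᵖ≡yᵖ ⟩
    y ^ p                    ∎)))
    where open ≡-Reasoning

  [x+1]^p≡x^p+1 : ∀ {p} → Prime p → p · 1# ≡ 0# → ∀ x → (x + 1#) ^ p ≡ x ^ p + 1#
  [x+1]^p≡x^p+1 {p} p-prime p·1≡0 x = trans (frobenius-+ p-prime p·1≡0 x 1#) (cong (x ^ p +_) (1^n≡1 p))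

  -- Poly d a f : f is a polynomial function of degree at most d whose coefficient of yᵈ is a.
  Poly : ℕ → Carrier → (Carrier → Carrier) → Set
  Poly zero    a f = ∀ y → f y ≡ a
  Poly (suc d) a f = ∃₂ λ c g → Poly d a g × (∀ y → f y ≡ c + y * g y)

  poly-cong : ∀ d {a f g} → Poly d a f → (∀ y → f y ≡ g y) → Poly d a g
  poly-cong zero    f≡a              f≡g y = trans (sym (f≡g y)) (f≡a y)
  poly-cong (suc d) (c , h , h-poly , f≡) f≡g = c , h , h-poly , λ y → trans (sym (f≡g y)) (f≡ y)

  poly-+ : ∀ d {a b f g} → Poly d a f → Poly d b g → Poly d (a + b) (λ y → f y + g y)
  poly-+ zero    f≡a g≡b y = cong₂ _+_ (f≡a y) (g≡b y)
  poly-+ (suc d) {f = f} {g} (c , f′ , f′-poly , f≡) (c′ , g′ , g′-poly , g≡) =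
    c + c′ , (λ y → f′ y + g′ y) , poly-+ d f′-poly g′-poly , λ y → begin
      f y + g y                          ≡⟨ cong₂ _+_ (f≡ y) (g≡ y) ⟩
      (c + y * f′ y) + (c′ + y * g′ y)
        ≡⟨ solve 5 (λ c c′ y u v → (c :+ y :* u) :+ (c′ :+ y :* v) := (c :+ c′) :+ y :* (u :+ v)) refl c c′ y (f′ y) (g′ y) ⟩
      (c + c′) + y * (f′ y + g′ y)       ∎
    where open ≡-Reasoning

  poly-scale : ∀ d {a f} s → Poly d a f → Poly d (s * a) (λ y → s * f y)
  poly-scale zero    s f≡a y = cong (s *_) (f≡a y)
  poly-scale (suc d) {f = f} s (c , g , g-poly , f≡) =
    s * c , (λ y → s * g y) , poly-scale d s g-poly , λ y → begin
      s * f y                  ≡⟨ cong (s *_) (f≡ y) ⟩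
      s * (c + y * g y)        ≡⟨ solve 4 (λ s c y u → s :* (c :+ y :* u) := s :* c :+ y :* (s :* u)) refl s c y (g y) ⟩
      s * c + y * (s * g y)    ∎
    where open ≡-Reasoning

  poly-raise : ∀ d {a f} → Poly d a f → Poly (suc d) 0# f
  poly-raise zero    {a} f≡a = a , (λ _ → 0#) , (λ _ → refl) , λ y → trans (f≡a y) (solve 2 (λ a y → a := a :+ y :* con 0) refl a y)
  poly-raise (suc d) (c , g , g-poly , f≡) = c , g , poly-raise d g-poly , f≡

  poly-lift : ∀ {d e a f} → Poly d a f → d < e → Poly e 0# f
  poly-lift {d} {suc e} f-poly (s≤s d≤e) with ℕ.m≤n⇒m<n∨m≡n d≤e
  ... | inj₁ d<e  = poly-raise e (poly-lift f-poly d<e)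
  ... | inj₂ refl = poly-raise d f-poly

  poly-y* : ∀ d {a f} → Poly d a f → Poly (suc d) a (λ y → y * f y)
  poly-y* d f-poly = 0# , _ , f-poly , λ y → sym (+-identityˡ _)

  poly-^ : ∀ d → Poly d 1# (_^ d)
  poly-^ zero    y = refl
  poly-^ (suc d) = poly-y* d (poly-^ d)

  poly-const : ∀ d c → Poly (suc d) 0# (λ _ → c)
  poly-const d c = poly-lift {zero} {a = c} (λ _ → refl) (s≤s z≤n)

  poly-neg : ∀ {d} → 1 < d → Poly d 0# -_
  poly-neg 1<d = poly-lift {1} neg-linear 1<d
    where
    neg-linear : Poly 1 (- 1#) -_
    neg-linear = 0# , (λ _ → - 1#) , (λ _ → refl) , λ y → begin
      - y            ≡⟨ cong -_ (*-identityʳ y) ⟨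
      - (y * 1#)     ≡⟨ -‿distribʳ-* y 1# ⟩
      y * - 1#       ≡⟨ +-identityˡ _ ⟨
      0# + y * - 1#  ∎
      where open ≡-Reasoning

  factor-theorem : ∀ d {a f} → Poly (suc d) a f → ∀ r →
                   ∃ λ h → Poly d a h × (∀ s → f (r + s) ≡ f r + s * h (r + s))
  factor-theorem zero {f = f} (c , g , g≡a , f≡) r = g , g≡a , λ s → begin
    f (r + s)                          ≡⟨ f≡ (r + s) ⟩
    c + (r + s) * g (r + s)            ≡⟨ solve 4 (λ c r s u → c :+ (r :+ s) :* u := (c :+ r :* u) :+ s :* u) refl c r s (g (r + s)) ⟩
    (c + r * g (r + s)) + s * g (r + s) ≡⟨ cong (λ u → (c + r * u) + s * g (r + s)) (trans (g≡a (r + s)) (sym (g≡a r))) ⟩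
    (c + r * g r) + s * g (r + s)      ≡⟨ cong (_+ s * g (r + s)) (f≡ r) ⟨
    f r + s * g (r + s)                ∎
    where open ≡-Reasoning
  factor-theorem (suc d) {a} {f} (c , g , g-poly , f≡) r with factor-theorem d g-poly r
  ... | h′ , h′-poly , g≡ = h , h-poly , λ s → begin
    f (r + s)                                       ≡⟨ f≡ (r + s) ⟩
    c + (r + s) * g (r + s)                         ≡⟨ cong (λ u → c + (r + s) * u) (g≡ s) ⟩
    c + (r + s) * (g r + s * h′ (r + s))
      ≡⟨ solve 5 (λ c r s u v → c :+ (r :+ s) :* (u :+ s :* v) := (c :+ r :* u) :+ s :* ((u :+ s :* v) :+ r :* v))
                 refl c r s (g r) (h′ (r + s)) ⟩
    (c + r * g r) + s * ((g r + s * h′ (r + s)) + r * h′ (r + s)) ≡⟨ cong₂ (λ u v → u + s * (v + r * h′ (r + s))) (f≡ r) (g≡ s) ⟨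
    f r + s * h (r + s)                             ∎
    where
    open ≡-Reasoning
    h : Carrier → Carrier
    h y = g y + r * h′ y
    h-poly : Poly (suc d) a h
    h-poly = subst (λ b → Poly (suc d) b h) (+-identityʳ a) (poly-+ (suc d) g-poly (poly-raise d (poly-scale d r h′-poly)))

  root-bound : ∀ d {a f} → Poly d a f → a ≢ 0# → ∀ {rs} → Unique rs → All (λ r → f r ≡ 0#) rs → length rs ≤ d
  root-bound d       _      _   {rs = []}    _ _ = z≤n
  root-bound zero    f≡a    a≢0 {rs = r ∷ _} _ (fr≡0 ∷ _) = contradiction (trans (sym (f≡a r)) fr≡0) a≢0
  root-bound (suc d) {f = f} f-poly a≢0 {r ∷ rs} (r∉rs ∷ rs!) (fr≡0 ∷ rs-roots) with factor-theorem d f-poly r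
  ... | h , h-poly , f≡ = s≤s (root-bound d h-poly a≢0 rs! (All.map h-root (All.zip (r∉rs , rs-roots))))
    where
    r+[s-r]≡s : ∀ s → r + (s + - r) ≡ s
    r+[s-r]≡s s = trans (+-comm r _) (//-rightDividesˡ r s)
    [s-r]*h[s]≡0 : ∀ {s} → f s ≡ 0# → (s + - r) * h s ≡ 0#
    [s-r]*h[s]≡0 {s} fs≡0 = begin
      (s + - r) * h s                      ≡⟨ +-identityˡ _ ⟨
      0# + (s + - r) * h s                 ≡⟨ cong₂ (λ u v → u + (s + - r) * h v) fr≡0 (r+[s-r]≡s s) ⟨
      f r + (s + - r) * h (r + (s + - r))  ≡⟨ f≡ (s + - r) ⟨
      f (r + (s + - r))                    ≡⟨ cong f (r+[s-r]≡s s) ⟩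
      f s                                  ≡⟨ fs≡0 ⟩
      0#                                   ∎
      where open ≡-Reasoning
    h-root : ∀ {s} → r ≢ s × f s ≡ 0# → h s ≡ 0#
    h-root {s} (r≢s , fs≡0) with x*y≡0⇒x≡0∨y≡0 ([s-r]*h[s]≡0 fs≡0)
    ... | inj₁ s-r≡0 = contradiction (sym (x∙y⁻¹≈ε⇒x≈y s r s-r≡0)) r≢s
    ... | inj₂ hs≡0  = hs≡0

  Δ : ℕ → Carrier → Carrier
  Δ m y = (y + 1#) ^ suc m + - (y ^ suc m)

  x≡z+y⇒x-y≡z : ∀ {x y z} → x ≡ z + y → x + - y ≡ z
  x≡z+y⇒x-y≡z {x} {y} {z} x≡z+y = trans (cong (_+ - y) x≡z+y) (//-rightDividesʳ y z)

  Δ[1+m]≡Δm+y*Δm+y^[1+m] : ∀ m y → Δ (suc m) y ≡ (Δ m y + y * Δ m y) + y ^ suc m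
  Δ[1+m]≡Δm+y*Δm+y^[1+m] m y = x≡z+y⇒x-y≡z (begin
    (y + 1#) * A                           ≡⟨ cong ((y + 1#) *_) (//-rightDividesˡ B A) ⟨
    (y + 1#) * (D + B)                     ≡⟨ solve 3 (λ y D B → (y :+ con 1) :* (D :+ B) := ((D :+ y :* D) :+ B) :+ y :* B) refl y D B ⟩
    ((D + y * D) + B) + y * B              ∎)
    where
    open ≡-Reasoning
    A = (y + 1#) ^ suc m
    B = y ^ suc m
    D = Δ m y

  poly-Δ : ∀ m → Poly m (suc m · 1#) (Δ m)
  poly-Δ zero y = begin
    (y + 1#) * 1# + - (y * 1#)   ≡⟨ cong₂ (λ u v → u + - v) (*-identityʳ _) (*-identityʳ y) ⟩
    (y + 1#) + - y               ≡⟨ cong (_+ - y) (+-comm y 1#) ⟩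
    (1# + y) + - y               ≡⟨ //-rightDividesʳ y 1# ⟩
    1#                           ≡⟨ +-identityʳ 1# ⟨
    1 · 1#                       ∎
    where open ≡-Reasoning
  poly-Δ (suc m) = poly-cong (suc m)
    (subst (λ a → Poly (suc m) a (λ y → (Δ m y + y * Δ m y) + y ^ suc m)) lc≡
      (poly-+ (suc m) (poly-+ (suc m) (poly-raise m (poly-Δ m)) (poly-y* m (poly-Δ m))) (poly-^ (suc m))))
    (λ y → sym (Δ[1+m]≡Δm+y*Δm+y^[1+m] m y))
    where
    lc≡ : (0# + suc m · 1#) + 1# ≡ suc (suc m) · 1#
    lc≡ = trans (cong (_+ 1#) (+-identityˡ _)) (+-comm _ 1#)

module EmbeddingProperties (F E : FiniteField) (ι : FiniteField.Carrier F → FiniteField.Carrier E) (ι-hom : IsRingHom F E ι) where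
  private
    module F = FiniteFieldProperties F
    module E = FiniteFieldProperties E
  open IsRingHom ι-hom

  ι-^ : ∀ x n → ι (x F.^ n) ≡ ι x E.^ n
  ι-^ x zero    = 1-hom
  ι-^ x (suc n) = trans (*-hom x (x F.^ n)) (cong (ι x E.*_) (ι-^ x n))

  ι-+1 : ∀ x → ι (x F.+ F.1#) ≡ ι x E.+ E.1#
  ι-+1 x = trans (+-hom x F.1#) (cong (ι x E.+_) 1-hom)

  ι-injective : ∀ {x y} → ι x ≡ ι y → x ≡ y
  ι-injective {x} {y} ιx≡ιy with (x F.+ F.- y) F.≟ F.0#
  ... | yes x-y≡0 = F.x∙y⁻¹≈ε⇒x≈y x y x-y≡0
  ... | no x-y≢0 with F.inverse _ x-y≢0
  ...   | z , [x-y]z≡1 = contradiction (begin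
    E.1#                      ≡⟨ 1-hom ⟨
    ι F.1#                    ≡⟨ cong ι [x-y]z≡1 ⟨
    ι ((x F.+ F.- y) F.* z)   ≡⟨ *-hom _ z ⟩
    ι (x F.+ F.- y) E.* ι z   ≡⟨ cong (E._* ι z) ι[x-y]≡0 ⟩
    E.0# E.* ι z              ≡⟨ E.zeroˡ (ι z) ⟩
    E.0#                      ∎) E.1≢0
    where
    open ≡-Reasoning
    ι[x-y]≡0 : ι (x F.+ F.- y) ≡ E.0#
    ι[x-y]≡0 = E.x+z≡z⇒x≡0 (begin
      ι (x F.+ F.- y) E.+ ι y     ≡⟨ +-hom _ y ⟨
      ι ((x F.+ F.- y) F.+ y)     ≡⟨ cong ι (F.//-rightDividesˡ y x) ⟩
      ι x                         ≡⟨ ιx≡ιy ⟩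
      ι y                         ∎)

  y^|F|≡y⇒∈image : ∀ {y} → y E.^ F.size ≡ y → ∃ λ x → ι x ≡ y
  y^|F|≡y⇒∈image {y} y^q≡y with any? (λ x → ι x E.≟ y) F.elements
  ... | yes y∈image = satisfied y∈image
  ... | no  y∉image = contradiction (E.root-bound q f-poly lc≢0 roots-unique all-roots) too-many-roots
    where
    q = F.size
    f : E.Carrier → E.Carrier
    f z = z E.^ q E.+ E.- z
    f-poly : E.Poly q (E.1# E.+ E.0#) f
    f-poly = E.poly-+ q (E.poly-^ q) (E.poly-neg F.1<size)
    lc≢0 : E.1# E.+ E.0# ≢ E.0#
    lc≢0 = E.1≢0 ∘ trans (sym (E.+-identityʳ E.1#))
    roots = y ∷ map ι F.elements
    roots-unique : Unique roots
    roots-unique = All.tabulate (λ z∈image y≡z → y∉image (image-witness z∈image y≡z)) ∷ Unique.map⁺ ι-injective F.elements-unique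
      where
      image-witness : ∀ {z} → z ∈ map ι F.elements → y ≡ z → Any (λ x → ι x ≡ y) F.elements
      image-witness z∈image y≡z with ∈-map⁻ ι z∈image
      ... | x , x∈elements , z≡ιx = lose x∈elements (sym (trans y≡z z≡ιx))
    all-roots : All (λ r → f r ≡ E.0#) roots
    all-roots = E.x≈y⇒x∙y⁻¹≈ε y^q≡y
              ∷ All.map⁺ (All.tabulate (λ {x} _ → E.x≈y⇒x∙y⁻¹≈ε (trans (sym (ι-^ x q)) (cong ι (F.x^size≡x x)))))
    too-many-roots : ¬ length roots ≤ q
    too-many-roots = ℕ.<⇒≱ (s≤s (ℕ.≤-reflexive (sym (trans (length-map ι F.elements) F.length-elements))))

  ι[x+1]^ℓ≡ιx^ℓ+1 : ∀ {ℓ} → Prime ℓ → ℓ F.· F.1# ≡ F.0# → ∀ x → ι (x F.+ F.1#) E.^ ℓ ≡ ι x E.^ ℓ E.+ E.1#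
  ι[x+1]^ℓ≡ιx^ℓ+1 {ℓ} ℓ-prime ℓ·1≡0 x = begin
    ι (x F.+ F.1#) E.^ ℓ       ≡⟨ ι-^ (x F.+ F.1#) ℓ ⟨
    ι ((x F.+ F.1#) F.^ ℓ)     ≡⟨ cong ι (F.[x+1]^p≡x^p+1 ℓ-prime ℓ·1≡0 x) ⟩
    ι (x F.^ ℓ F.+ F.1#)       ≡⟨ ι-+1 (x F.^ ℓ) ⟩
    ι (x F.^ ℓ) E.+ E.1#       ≡⟨ cong (E._+ E.1#) (ι-^ x ℓ) ⟩
    ι x E.^ ℓ E.+ E.1#         ∎
    where open ≡-Reasoning

  module _ (ω : E.Carrier) (k a b : ℕ) where
    A B : E.Carrier
    A = ω E.^ (a ℕ.* k)
    B = ω E.^ (b ℕ.* k)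

    InT : ℕ → F.Carrier → Set
    InT ℓ x = ι x E.^ ℓ ≡ A × ι (x F.+ F.1#) E.^ ℓ ≡ B

    InT? : ∀ ℓ x → Dec (InT ℓ x)
    InT? ℓ x = (ι x E.^ ℓ E.≟ A) ×-dec (ι (x F.+ F.1#) E.^ ℓ E.≟ B)

    #T≡1 : ∀ {ℓ n} → Prime ℓ → F.size ≡ ℓ ℕ.^ suc n → A E.^ F.size ≡ A →
           (E.1# E.+ A) E.+ E.- B ≡ E.0# → #T F E ι ω ℓ k a b ≡ 1
    #T≡1 {ℓ} {n} ℓ-prime |F|≡ℓ^[1+n] A^|F|≡A 1+A-B≡0 with y^|F|≡y⇒∈image A^|F|≡A
    ... | α , ια≡A = length-filter≡1 (InT? ℓ) F.elements-unique (F.∈-elements β) (ιβ^ℓ≡A , ι[β+1]^ℓ≡B) InT⇒≡β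
      where
      ℓ·1≡0 = F.size≡p^n⇒p·1≡0 {ℓ} {suc n} (s≤s z≤n) |F|≡ℓ^[1+n]
      β = α F.^ (ℓ ℕ.^ n)
      ιβ^ℓ≡A : ι β E.^ ℓ ≡ A
      ιβ^ℓ≡A = trans (sym (ι-^ β ℓ)) (trans (cong ι (F.[x^[p^n]]^p≡x {ℓ} {n} |F|≡ℓ^[1+n] α)) ια≡A)
      ι[β+1]^ℓ≡B : ι (β F.+ F.1#) E.^ ℓ ≡ B
      ι[β+1]^ℓ≡B = begin
        ι (β F.+ F.1#) E.^ ℓ   ≡⟨ ι[x+1]^ℓ≡ιx^ℓ+1 ℓ-prime ℓ·1≡0 β ⟩
        ι β E.^ ℓ E.+ E.1#     ≡⟨ cong (E._+ E.1#) ιβ^ℓ≡A ⟩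
        A E.+ E.1#             ≡⟨ E.+-comm A E.1# ⟩
        E.1# E.+ A             ≡⟨ E.x∙y⁻¹≈ε⇒x≈y _ B 1+A-B≡0 ⟩
        B                      ∎
        where open ≡-Reasoning
      InT⇒≡β : ∀ {y} → InT ℓ y → y ≡ β
      InT⇒≡β {y} (ιy^ℓ≡A , _) = F.frobenius-injective ℓ-prime ℓ·1≡0
        (ι-injective (trans (ι-^ y ℓ) (trans ιy^ℓ≡A (trans (sym ιβ^ℓ≡A) (sym (ι-^ β ℓ))))))

    #T≡0 : ∀ {ℓ} → Prime ℓ → ℓ F.· F.1# ≡ F.0# → (E.1# E.+ A) E.+ E.- B ≢ E.0# → #T F E ι ω ℓ k a b ≡ 0
    #T≡0 {ℓ} ℓ-prime ℓ·1≡0 1+A-B≢0 = cong length (filter-none (InT? ℓ) {xs = F.elements} (All.tabulate (λ _ → ¬InT)))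
      where
      ¬InT : ∀ {x} → ¬ InT ℓ x
      ¬InT {x} (ιx^ℓ≡A , ι[x+1]^ℓ≡B) = 1+A-B≢0 (E.x≈y⇒x∙y⁻¹≈ε (begin
        E.1# E.+ A                ≡⟨ E.+-comm E.1# A ⟩
        A E.+ E.1#                ≡⟨ cong (E._+ E.1#) ιx^ℓ≡A ⟨
        ι x E.^ ℓ E.+ E.1#        ≡⟨ ι[x+1]^ℓ≡ιx^ℓ+1 ℓ-prime ℓ·1≡0 x ⟨
        ι (x F.+ F.1#) E.^ ℓ      ≡⟨ ι[x+1]^ℓ≡B ⟩
        B                         ∎))
        where open ≡-Reasoning

    #T≤ℓ∸1 : ∀ {ℓ} → Prime ℓ → ℓ E.· E.1# ≢ E.0# → #T F E ι ω ℓ k a b ≤ ℓ ∸ 1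
    #T≤ℓ∸1 {0} ℓ-prime = contradiction ℓ-prime ¬prime[0]
    #T≤ℓ∸1 {1} ℓ-prime = contradiction ℓ-prime ¬prime[1]
    #T≤ℓ∸1 {ℓ@(suc (suc m))} _ ℓ·1≢0 = subst (_≤ suc m) (length-map ι T)
      (E.root-bound (suc m) g-poly ℓ·1≢0 (Unique.map⁺ ι-injective (Unique.filter⁺ (InT? ℓ) F.elements-unique))
        (All.map⁺ (All.map root (All.all-filter (InT? ℓ) F.elements))))
      where
      T = filter (InT? ℓ) F.elements
      g : E.Carrier → E.Carrier
      g y = E.Δ (suc m) y E.+ E.- (B E.+ E.- A)
      g-poly : E.Poly (suc m) (ℓ E.· E.1#) g
      g-poly = subst (λ c → E.Poly (suc m) c g) (E.+-identityʳ _) (E.poly-+ (suc m) (E.poly-Δ (suc m)) (E.poly-const m _))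
      root : ∀ {x} → InT ℓ x → g (ι x) ≡ E.0#
      root {x} (ιx^ℓ≡A , ι[x+1]^ℓ≡B) = E.x≈y⇒x∙y⁻¹≈ε
        (cong₂ (λ u v → u E.+ E.- v) (trans (cong (E._^ ℓ) (sym (ι-+1 x))) ι[x+1]^ℓ≡B) ιx^ℓ≡A)

-- Imported this late because unqualified ℕ operators would clash with the field operations above.
open import Data.Nat using (_^_; _*_)

proposition5p2 : (ℓ p n : ℕ) → Prime ℓ → ℓ ≢ 2 → Prime p → 1 ≤ n →
    (F E : FiniteField) → FiniteField.size F ≡ p ^ n → FiniteField.size E ≡ (p ^ n) ^ ℓ →
    (ι : FiniteField.Carrier F → FiniteField.Carrier E) → IsRingHom F E ι →
    (ω : FiniteField.Carrier E) → FiniteField.IsGenerator E ω →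
    (a b : ℕ) → a ≤ p ^ n ∸ 2 → b ≤ p ^ n ∸ 2 →
    (p ≡ ℓ →
      (FiniteField._+_ E (FiniteField._+_ E (FiniteField.1# E) (FiniteField._^_ E ω (a * kOf (p ^ n) ℓ)))
         (FiniteField.-_ E (FiniteField._^_ E ω (b * kOf (p ^ n) ℓ))) ≡ FiniteField.0# E →
         #T F E ι ω ℓ (kOf (p ^ n) ℓ) a b ≡ 1)
      × (FiniteField._+_ E (FiniteField._+_ E (FiniteField.1# E) (FiniteField._^_ E ω (a * kOf (p ^ n) ℓ)))
         (FiniteField.-_ E (FiniteField._^_ E ω (b * kOf (p ^ n) ℓ))) ≢ FiniteField.0# E →
         #T F E ι ω ℓ (kOf (p ^ n) ℓ) a b ≡ 0))
    × (p ≢ ℓ → #T F E ι ω ℓ (kOf (p ^ n) ℓ) a b ≤ ℓ ∸ 1)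
proposition5p2 ℓ p (suc n) ℓ-prime _ p-prime (s≤s z≤n) F E |F|≡q |E|≡q^ℓ ι ι-hom ω (ω≢0 , _) a b _ _ =
  (λ { refl → #T≡1 ω k a b {n = n} ℓ-prime |F|≡q A^|F|≡A , #T≡0 ω k a b ℓ-prime p·1≡0ᶠ }) ,
  λ p≢ℓ → #T≤ℓ∸1 ω k a b ℓ-prime (E.coprime∧m·1≡0⇒n·1≢0 (distinct-primes⇒coprime p-prime ℓ-prime p≢ℓ) p·1≡0ᴱ)
  where
  open EmbeddingProperties F E ι ι-hom
  module F = FiniteFieldProperties F
  module E = FiniteFieldProperties E
  k = kOf (p ^ suc n) ℓ
  A^|F|≡A : (ω E.^ (a * k)) E.^ F.size ≡ ω E.^ (a * k)
  A^|F|≡A = subst (λ m → (ω E.^ (a * k)) E.^ m ≡ ω E.^ (a * k)) (sym |F|≡q)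
    (E.x^[j*k]^q≡x^[j*k] |E|≡q^ℓ (subst (1 <_) |F|≡q F.1<size) ω≢0 a)
  p·1≡0ᶠ : p F.· F.1# ≡ F.0#
  p·1≡0ᶠ = F.size≡p^n⇒p·1≡0 {p} {suc n} (s≤s z≤n) |F|≡q
  p·1≡0ᴱ : p E.· E.1# ≡ E.0#
  p·1≡0ᴱ = E.size≡p^n⇒p·1≡0 {p} {suc n * ℓ}
    (ℕ.*-mono-< {0} {suc n} (s≤s z≤n) (ℕ.>-nonZero⁻¹ ℓ {{prime⇒nonZero ℓ-prime}}))
    (trans |E|≡q^ℓ (ℕ.^-*-assoc p (suc n) ℓ))
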